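{- Let $\mathscr{A}$ be a closed set of impartial games with $\mathscr{A}\neq\{0\}$, misère quotient $(\mathcal{Q},\mathcal{P})$ and quotient map $\Phi$. Let $x\in\mathcal{Q}$ and let $G$ be a game all of whose options lie in $\mathscr{A}$ with $\Phi''G=\mathcal{M}_x$. Then $\mathcal{Q}(\mathrm{cl}(\mathscr{A}\cup\{G\}))\cong\mathcal{Q}(\mathscr{A})$ and $\Phi(G)=x$; precisely, with $\mathscr{B}=\mathrm{cl}(\mathscr{A}\cup\{G\})$: for $K,K'\in\mathscr{A}$, $K\equiv_{\mathscr{A}}K'$ iff $K\equiv_{\mathscr{B}}K'$, every element of $\mathscr{B}$ is $\equiv_{\mathscr{B}}$-equivalent to an element of $\mathscr{A}$, and $G\equiv_{\mathscr{B}}H$ for every $H\in\mathscr{A}$ with $\Phi(H)=x$.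
   Context: All games are impartial; $G+H$ is the disjunctive sum. In misère play the last player to move loses; $o^-(G)$ is the misère outcome. A set is closed if closed under sums and under taking options; $\mathrm{cl}(\mathscr{S})$ is the smallest closed superset. For closed $\mathscr{C}$, $K\equiv_{\mathscr{C}}K'$ iff $o^-(K+X)=o^-(K'+X)$ for all $X\in\mathscr{C}$; $\mathcal{Q}(\mathscr{C})$ is $(\mathscr{C}/\equiv_{\mathscr{C}},\text{classes of misère }\mathscr{P}\text{ -positions})$. $\Phi:\mathscr{A}\to\mathcal{Q}$ is the quotient map. $\Phi''G=\{\Phi(G'):G'\text{ an option of }G\}$. The meximal set of $x$ is $\mathcal{M}_x=\{y\in\mathcal{Q}:\text{no }w\in\mathcal{Q}\text{ has both }xw,yw\in\mathcal{P}\}$. -}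

module Defs where

open import Data.Nat using (ℕ; zero; suc; _+_)
open import Data.Fin using (Fin; splitAt)
import Data.Fin as Fin
open import Data.Sum using (_⊎_; inj₁; inj₂; [_,_])
open import Data.Product using (Σ; ∃; _×_; _,_)
open import Relation.Binary.PropositionalEquality using (_≡_)
open import Relation.Nullary using (¬_)

data Game : Set where
  mk : (n : ℕ) → (Fin n → Game) → Game

zeroG : Game
zeroG = mk 0 (λ ())

#opts : Game → ℕ
#opts (mk n _) = n

Option : Game → Game → Set
Option G' (mk n f) = Σ (Fin n) λ i → f i ≡ G'

infixl 6 _⊕_
_⊕_ : Game → Game → Game
mk n f ⊕ mk m g =
  mk (n + m) (λ k → [ (λ i → f i ⊕ mk m g) , (λ j → mk n f ⊕ g j) ] (splitAt n k))

data Outcome : Set where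
  𝒩 𝒫 : Outcome

allFin : (n : ℕ) → (Fin n → Outcome) → Outcome
allFin zero    p = 𝒫
allFin (suc n) p = both (p Fin.zero) (allFin n (λ i → p (Fin.suc i)))
  where
  both : Outcome → Outcome → Outcome
  both 𝒫 𝒫 = 𝒫
  both _ _ = 𝒩

-- misère play: the player unable to move wins (last player to move loses).
-- A position is 𝒫 iff it has at least one option and every option is 𝒩.
o⁻ : Game → Outcome
o⁻ (mk zero f)    = 𝒩
o⁻ (mk (suc n) f) = allFin (suc n) (λ i → flip (o⁻ (f i)))
  where
  flip : Outcome → Outcome
  flip 𝒩 = 𝒫
  flip 𝒫 = 𝒩

GameSet : Set₁
GameSet = Game → Set

Closed : GameSet → Set
Closed 𝒞 = (∀ G H → 𝒞 G → 𝒞 H → 𝒞 (G ⊕ H))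
         × (∀ G G' → 𝒞 G → Option G' G → 𝒞 G')

data cl (S : GameSet) : GameSet where
  base : ∀ {G} → S G → cl S G
  sum  : ∀ {G H} → cl S G → cl S H → cl S (G ⊕ H)
  opt  : ∀ {G G'} → cl S G → Option G' G → cl S G'

_∪｛_｝ : GameSet → Game → GameSet
(S ∪｛ G ｝) K = S K ⊎ K ≡ G

_≡[_]_ : Game → GameSet → Game → Set
K ≡[ 𝒞 ] K' = ∀ X → 𝒞 X → o⁻ (K ⊕ X) ≡ o⁻ (K' ⊕ X)

-- Elements of the quotient 𝒬(𝒜) are represented by games in 𝒜 (Φ(K) for K ∈ 𝒜);
-- Φ(K) = Φ(K') iff K ≡[ 𝒜 ] K'.  The product Φ(K)Φ(W) is Φ(K ⊕ W) and
-- Φ(K) ∈ 𝒫 iff o⁻ K ≡ 𝒫.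

-- Φ(Y) ∈ 𝓜_{Φ(X)}: no w ∈ 𝒬 with xw ∈ 𝒫 and yw ∈ 𝒫
InMeximal : GameSet → (X Y : Game) → Set
InMeximal 𝒜 X Y = ¬ (Σ Game λ W → 𝒜 W × o⁻ (X ⊕ W) ≡ 𝒫 × o⁻ (Y ⊕ W) ≡ 𝒫)

-- Φ''G = 𝓜_{Φ(X)} as subsets of 𝒬(𝒜) (options of G assumed to lie in 𝒜)
OptionImageIsMeximal : GameSet → (G X : Game) → Set
OptionImageIsMeximal 𝒜 G X =
    (∀ G' → Option G' G → InMeximal 𝒜 X G')
  × (∀ Y → 𝒜 Y → InMeximal 𝒜 X Y → Σ Game λ G' → Option G' G × G' ≡[ 𝒜 ] Y)

{-# OPTIONS --safe #-}
module Submission where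

-- Every game of ℬ = cl(𝒜 ∪ {G}) is bisimilar to Y ⊕[ k ] G (Y plus k copies of G) with Y ∈ 𝒜,
-- and replacing the copies of G by copies of X preserves misère outcomes:
-- o⁻ (Y ⊕[ k ] G) = o⁻ (Y ⊕[ k ] X), by induction on k and then on Y.  With W = Y ⊕[ k ] X,
-- Y ⊕[ k + 1 ] X = X ⊕ W.  The options of Y ⊕[ k + 1 ] G are Y' ⊕[ k + 1 ] G, handled by
-- induction, and (G' ⊕ Y) ⊕[ k ] G, whose outcome is that of G' ⊕ W.  If X ⊕ W ∈ 𝒫, no G' ⊕ W
-- is in 𝒫 because G' ∈ 𝓜_x.  If X ⊕ W ∈ 𝒩, it has a 𝒫-option Y' ⊕[ k + 1 ] X, or a 𝒫-option
-- X' ⊕ W with X' ∈ 𝓜_x, or no option at all, and then X = W = 0 and ⋆ ∈ 𝓜_x with ⋆ ⊕ W ∈ 𝒫;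
-- as Φ''G = 𝓜_x, some option G' of G is 𝒜-equivalent to that element of 𝓜_x, giving a
-- 𝒫-option of Y ⊕[ k + 1 ] G.  The hypothesis 𝒜 ≠ {0} is what puts ⋆ and 0 into 𝒜.

open import Defs
open import Algebra.Bundles using (CommutativeMonoid)
open import Algebra.Structures using (IsCommutativeMonoid)
open import Data.Empty using (⊥; ⊥-elim)
open import Data.Fin using (Fin; zero; suc; splitAt; _↑ˡ_; _↑ʳ_; fromℕ<)
open import Data.Fin.Properties using (¬Fin0; splitAt-↑ˡ; splitAt-↑ʳ; any?)
open import Data.Nat using (ℕ; zero; suc; _+_; _>_)
open import Data.Nat.Properties using (m+n≡0⇒m≡0; m+n≡0⇒n≡0; n≤0⇒n≡0; ≮⇒≥; _<?_)
open import Data.Product using (Σ; ∃; _×_; _,_; proj₁; proj₂)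
open import Data.Sum using (_⊎_; inj₁; inj₂; [_,_]′)
open import Data.Vec.Functional using (_∷_)
open import Function.Bundles using (_⇔_; mk⇔)
open import Level using (0ℓ)
open import Relation.Binary.PropositionalEquality
  using (_≡_; _≢_; refl; sym; trans; subst; module ≡-Reasoning)
open import Relation.Binary.Structures using (IsEquivalence)
open import Relation.Nullary using (yes; no)

≢𝒫⇒≡𝒩 : ∀ {a} → a ≢ 𝒫 → a ≡ 𝒩
≢𝒫⇒≡𝒩 {𝒩} _ = refl
≢𝒫⇒≡𝒩 {𝒫} a≢𝒫 = ⊥-elim (a≢𝒫 refl)

≢𝒩⇒≡𝒫 : ∀ {a} → a ≢ 𝒩 → a ≡ 𝒫
≢𝒩⇒≡𝒫 {𝒫} _ = refl
≢𝒩⇒≡𝒫 {𝒩} a≢𝒩 = ⊥-elim (a≢𝒩 refl)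

𝒩≢𝒫 : 𝒩 ≢ 𝒫
𝒩≢𝒫 ()

outcome-by-cases : ∀ {a b} → (b ≡ 𝒫 → a ≡ 𝒫) → (b ≡ 𝒩 → a ≡ 𝒩) → a ≡ b
outcome-by-cases {b = 𝒫} b𝒫⇒a𝒫 _ = b𝒫⇒a𝒫 refl
outcome-by-cases {b = 𝒩} _ b𝒩⇒a𝒩 = b𝒩⇒a𝒩 refl

allFin-𝒫 : ∀ {n p} → allFin n p ≡ 𝒫 → ∀ i → p i ≡ 𝒫
allFin-𝒫 {suc n} {p} _ i with p zero in p₀ | allFin n (λ i → p (suc i)) in rest
allFin-𝒫 _ zero    | 𝒫 | 𝒫 = p₀
allFin-𝒫 _ (suc i) | 𝒫 | 𝒫 = allFin-𝒫 rest i

allFin-𝒩 : ∀ {n p} → allFin n p ≡ 𝒩 → ∃ λ i → p i ≡ 𝒩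
allFin-𝒩 {suc n} {p} _ with p zero in p₀ | allFin n (λ i → p (suc i)) in rest
... | 𝒩 | _ = zero , p₀
... | 𝒫 | 𝒩 = let i , pᵢ = allFin-𝒩 rest in suc i , pᵢ

opts : (G : Game) → Fin (#opts G) → Game
opts (mk _ f) = f

opts-option : ∀ G i → Option (opts G i) G
opts-option (mk _ _) i = i , refl

option-index : ∀ {G' G} → Option G' G → Σ (Fin (#opts G)) λ i → opts G i ≡ G'
option-index {G = mk _ _} o = o

-- o⁻ negates the outcomes of the options with a function local to Defs, which
-- cannot be named here; writing the family as _ ∷ _ lets Agda infer it.
𝒫⇒options-𝒩 : ∀ G → o⁻ G ≡ 𝒫 → ∀ i → o⁻ (opts G i) ≡ 𝒩
𝒫⇒options-𝒩 (mk (suc n) f) G𝒫 zero with o⁻ (f zero) | allFin-𝒫 {suc n} {_ ∷ _} G𝒫 zero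
... | 𝒩 | _ = refl
... | 𝒫 | ()
𝒫⇒options-𝒩 (mk (suc n) f) G𝒫 (suc i) with o⁻ (f (suc i)) | allFin-𝒫 {suc n} {_ ∷ _} G𝒫 (suc i)
... | 𝒩 | _ = refl
... | 𝒫 | ()

𝒩-cases : ∀ G → o⁻ G ≡ 𝒩 → #opts G ≡ 0 ⊎ ∃ λ i → o⁻ (opts G i) ≡ 𝒫
𝒩-cases (mk zero _) _ = inj₁ refl
𝒩-cases (mk (suc n) f) G𝒩 with allFin-𝒩 {suc n} {_ ∷ _} G𝒩
... | zero , flip-𝒩 with o⁻ (f zero) in fᵢ | flip-𝒩
...   | 𝒫 | _ = inj₂ (zero , fᵢ)
𝒩-cases (mk (suc n) f) G𝒩 | suc i , flip-𝒩 with o⁻ (f (suc i)) in fᵢ | flip-𝒩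
...   | 𝒫 | _ = inj₂ (suc i , fᵢ)

𝒫⇒has-option : ∀ G → o⁻ G ≡ 𝒫 → Fin (#opts G)
𝒫⇒has-option (mk (suc _) _) _ = zero

options-𝒩⇒𝒫 : ∀ G → Fin (#opts G) → (∀ i → o⁻ (opts G i) ≡ 𝒩) → o⁻ G ≡ 𝒫
options-𝒩⇒𝒫 G i₀ options-𝒩 = ≢𝒩⇒≡𝒫 λ G𝒩 → case (𝒩-cases G G𝒩)
  where
  case : #opts G ≡ 0 ⊎ ∃ (λ i → o⁻ (opts G i) ≡ 𝒫) → ⊥
  case (inj₁ no-options) = ¬Fin0 (subst Fin no-options i₀)
  case (inj₂ (i , i𝒫))   = 𝒩≢𝒫 (trans (sym (options-𝒩 i)) i𝒫)

𝒫-option⇒𝒩 : ∀ G i → o⁻ (opts G i) ≡ 𝒫 → o⁻ G ≡ 𝒩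
𝒫-option⇒𝒩 G i i𝒫 = ≢𝒫⇒≡𝒩 λ G𝒫 → 𝒩≢𝒫 (trans (sym (𝒫⇒options-𝒩 G G𝒫 i)) i𝒫)

-- Bisimilarity and sums

infix 4 _≈_ _≈∈_ _≲_

-- ⊕ is associative and commutative only up to bisimilarity, which o⁻ respects.
mutual
  data _≈_ : Game → Game → Set where
    bisim : ∀ {n m f g} → (∀ i → f i ≈∈ mk m g) → (∀ j → g j ≈∈ mk n f) → mk n f ≈ mk m g

  record _≈∈_ (Z G : Game) : Set where
    inductive
    constructor ≈opt
    field
      index : Fin (#opts G)
      ≈opts : Z ≈ opts G index

open _≈∈_ using (index; ≈opts)

_≲_ : Game → Game → Set
G ≲ H = ∀ i → opts G i ≈∈ H

≈-intro : ∀ {G H} → G ≲ H → H ≲ G → G ≈ H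
≈-intro {mk _ _} {mk _ _} = bisim

≈-fwd : ∀ {G H} → G ≈ H → G ≲ H
≈-fwd (bisim G≲H _) = G≲H

≈-bwd : ∀ {G H} → G ≈ H → H ≲ G
≈-bwd (bisim _ H≲G) = H≲G

≈-refl : ∀ {G} → G ≈ G
≈-refl {mk _ _} = bisim (λ i → ≈opt i ≈-refl) (λ i → ≈opt i ≈-refl)

≈-reflexive : ∀ {G H} → G ≡ H → G ≈ H
≈-reflexive refl = ≈-refl

≈-sym : ∀ {G H} → G ≈ H → H ≈ G
≈-sym (bisim G≲H H≲G) = bisim H≲G G≲H

≈-trans : ∀ {G H K} → G ≈ H → H ≈ K → G ≈ K
≈-trans (bisim G≲H H≲G) (bisim H≲K K≲H) = bisim
  (λ i → let ≈opt j r = G≲H i ; ≈opt k s = H≲K j in ≈opt k (≈-trans r s))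
  (λ k → let ≈opt j s = K≲H k ; ≈opt i r = H≲G j in ≈opt i (≈-trans s r))

≈-isEquivalence : IsEquivalence _≈_
≈-isEquivalence = record { refl = ≈-refl ; sym = ≈-sym ; trans = ≈-trans }

≈∈-respˡ : ∀ {Z Z' G} → Z ≈ Z' → Z' ≈∈ G → Z ≈∈ G
≈∈-respˡ Z≈Z' (≈opt i r) = ≈opt i (≈-trans Z≈Z' r)

≈∈-respʳ : ∀ {Z G H} → G ≈ H → Z ≈∈ G → Z ≈∈ H
≈∈-respʳ G≈H (≈opt i r) = ≈∈-respˡ r (≈-fwd G≈H i)

𝒫-resp-≈ : ∀ {G H} → G ≈ H → o⁻ G ≡ 𝒫 → o⁻ H ≡ 𝒫
𝒫-resp-≈ {G} {H} (bisim G≲H H≲G) G𝒫 =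
  options-𝒩⇒𝒫 H (index (G≲H (𝒫⇒has-option G G𝒫))) λ j →
    let ≈opt i r = H≲G j in
    ≢𝒫⇒≡𝒩 λ j𝒫 → 𝒩≢𝒫 (trans (sym (𝒫⇒options-𝒩 G G𝒫 i)) (𝒫-resp-≈ r j𝒫))

o⁻-resp-≈ : ∀ {G H} → G ≈ H → o⁻ G ≡ o⁻ H
o⁻-resp-≈ G≈H = outcome-by-cases (𝒫-resp-≈ (≈-sym G≈H))
  (λ H𝒩 → ≢𝒫⇒≡𝒩 λ G𝒫 → 𝒩≢𝒫 (trans (sym H𝒩) (𝒫-resp-≈ G≈H G𝒫)))

≈∈-𝒫⇒𝒩 : ∀ {Z G} → Z ≈∈ G → o⁻ Z ≡ 𝒫 → o⁻ G ≡ 𝒩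
≈∈-𝒫⇒𝒩 {G = G} (≈opt i r) Z𝒫 = 𝒫-option⇒𝒩 G i (𝒫-resp-≈ r Z𝒫)

𝒫⇒≈∈-𝒩 : ∀ {Z G} → o⁻ G ≡ 𝒫 → Z ≈∈ G → o⁻ Z ≡ 𝒩
𝒫⇒≈∈-𝒩 G𝒫 Z≈∈G = ≢𝒫⇒≡𝒩 λ Z𝒫 → 𝒩≢𝒫 (trans (sym (≈∈-𝒫⇒𝒩 Z≈∈G Z𝒫)) G𝒫)

no-options⇒≈zeroG : ∀ G → #opts G ≡ 0 → G ≈ zeroG
no-options⇒≈zeroG (mk zero _) _ = bisim (λ ()) (λ ())

⋆ : Game
⋆ = mk 1 (λ _ → zeroG)

⊕-option : ∀ G H k → (Σ (Fin (#opts G)) λ i → opts (G ⊕ H) k ≡ opts G i ⊕ H)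
                   ⊎ (Σ (Fin (#opts H)) λ j → opts (G ⊕ H) k ≡ G ⊕ opts H j)
⊕-option (mk n f) (mk m g) k with splitAt n k
... | inj₁ i = inj₁ (i , refl)
... | inj₂ j = inj₂ (j , refl)

opts-⊕-↑ˡ : ∀ {n m} f g (i : Fin n) → opts (mk n f ⊕ mk m g) (i ↑ˡ m) ≡ f i ⊕ mk m g
opts-⊕-↑ˡ {n} {m} f g i rewrite splitAt-↑ˡ n i m = refl

opts-⊕-↑ʳ : ∀ {n m} f g (j : Fin m) → opts (mk n f ⊕ mk m g) (n ↑ʳ j) ≡ mk n f ⊕ g j
opts-⊕-↑ʳ {n} {m} f g j rewrite splitAt-↑ʳ n m j = refl

⊕-optionˡ : ∀ G H i → opts G i ⊕ H ≈∈ G ⊕ H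
⊕-optionˡ (mk n f) (mk m g) i = ≈opt (i ↑ˡ m) (≈-reflexive (sym (opts-⊕-↑ˡ f g i)))

⊕-optionʳ : ∀ G H j → G ⊕ opts H j ≈∈ G ⊕ H
⊕-optionʳ (mk n f) (mk m g) j = ≈opt (n ↑ʳ j) (≈-reflexive (sym (opts-⊕-↑ʳ f g j)))

⊕-≲ : ∀ A B {C} → (∀ i → opts A i ⊕ B ≈∈ C) → (∀ j → A ⊕ opts B j ≈∈ C) → A ⊕ B ≲ C
⊕-≲ A B left right k with ⊕-option A B k
... | inj₁ (i , e) = ≈∈-respˡ (≈-reflexive e) (left i)
... | inj₂ (j , e) = ≈∈-respˡ (≈-reflexive e) (right j)

#opts-⊕≡0 : ∀ G H → #opts (G ⊕ H) ≡ 0 → #opts G ≡ 0 × #opts H ≡ 0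
#opts-⊕≡0 (mk n _) (mk _ _) none = m+n≡0⇒m≡0 n none , m+n≡0⇒n≡0 n none

mutual
  ⊕-cong : ∀ {A A' B B'} → A ≈ A' → B ≈ B' → A ⊕ B ≈ A' ⊕ B'
  ⊕-cong A≈A' B≈B' = ≈-intro (⊕-cong-≲ A≈A' B≈B') (⊕-cong-≲ (≈-sym A≈A') (≈-sym B≈B'))

  ⊕-cong-≲ : ∀ {A A' B B'} → A ≈ A' → B ≈ B' → A ⊕ B ≲ A' ⊕ B'
  -- The implicit arguments of the recursive calls are explicit for the termination checker.
  ⊕-cong-≲ {A@(mk _ f)} {A'@(mk _ f')} {B@(mk _ g)} {B'@(mk _ g')} A≈A' B≈B' = ⊕-≲ A B
    (λ i → let ≈opt i' r = ≈-fwd A≈A' i in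
           ≈∈-respˡ (⊕-cong {f i} {f' i'} r B≈B') (⊕-optionˡ A' B' i'))
    (λ j → let ≈opt j' r = ≈-fwd B≈B' j in
           ≈∈-respˡ (⊕-cong {B = g j} {g' j'} A≈A' r) (⊕-optionʳ A' B' j'))

⊕-congˡ : ∀ {A B B'} → B ≈ B' → A ⊕ B ≈ A ⊕ B'
⊕-congˡ = ⊕-cong ≈-refl

⊕-congʳ : ∀ {A A' B} → A ≈ A' → A ⊕ B ≈ A' ⊕ B
⊕-congʳ A≈A' = ⊕-cong A≈A' ≈-refl

≈∈-⊕ˡ : ∀ {Z G H} → Z ≈∈ G → Z ⊕ H ≈∈ G ⊕ H
≈∈-⊕ˡ {G = G} {H} (≈opt i r) = ≈∈-respˡ (⊕-congʳ r) (⊕-optionˡ G H i)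

≈∈-⊕ʳ : ∀ {Z G H} → Z ≈∈ H → G ⊕ Z ≈∈ G ⊕ H
≈∈-⊕ʳ {G = G} {H} (≈opt j r) = ≈∈-respˡ (⊕-congˡ r) (⊕-optionʳ G H j)

mutual
  ⊕-comm : ∀ A B → A ⊕ B ≈ B ⊕ A
  ⊕-comm A B = ≈-intro (⊕-comm-≲ A B) (⊕-comm-≲ B A)

  ⊕-comm-≲ : ∀ A B → A ⊕ B ≲ B ⊕ A
  ⊕-comm-≲ A@(mk _ f) B@(mk _ g) = ⊕-≲ A B
    (λ i → ≈∈-respˡ (⊕-comm (f i) B) (⊕-optionʳ B A i))
    (λ j → ≈∈-respˡ (⊕-comm A (g j)) (⊕-optionˡ B A j))

mutual
  ⊕-assoc : ∀ A B C → (A ⊕ B) ⊕ C ≈ A ⊕ (B ⊕ C)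
  ⊕-assoc A B C = ≈-intro (⊕-assoc-≲ A B C) (⊕-assoc-≳ A B C)

  ⊕-assoc-≲ : ∀ A B C → (A ⊕ B) ⊕ C ≲ A ⊕ (B ⊕ C)
  ⊕-assoc-≲ A@(mk _ f) B@(mk _ g) C@(mk _ h) = ⊕-≲ (A ⊕ B) C
    (λ k → [ (λ (i , e) → ≈∈-respˡ (≈-trans (⊕-congʳ (≈-reflexive e)) (⊕-assoc (f i) B C))
                                   (⊕-optionˡ A (B ⊕ C) i))
           , (λ (j , e) → ≈∈-respˡ (≈-trans (⊕-congʳ (≈-reflexive e)) (⊕-assoc A (g j) C))
                                   (≈∈-⊕ʳ (⊕-optionˡ B C j)))
           ]′ (⊕-option A B k))
    (λ l → ≈∈-respˡ (⊕-assoc A B (h l)) (≈∈-⊕ʳ (⊕-optionʳ B C l)))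

  ⊕-assoc-≳ : ∀ A B C → A ⊕ (B ⊕ C) ≲ (A ⊕ B) ⊕ C
  ⊕-assoc-≳ A@(mk _ f) B@(mk _ g) C@(mk _ h) = ⊕-≲ A (B ⊕ C)
    (λ i → ≈∈-respˡ (≈-sym (⊕-assoc (f i) B C)) (≈∈-⊕ˡ (⊕-optionˡ A B i)))
    (λ k → [ (λ (j , e) → ≈∈-respˡ (≈-trans (⊕-congˡ (≈-reflexive e)) (≈-sym (⊕-assoc A (g j) C)))
                                   (≈∈-⊕ˡ (⊕-optionʳ A B j)))
           , (λ (l , e) → ≈∈-respˡ (≈-trans (⊕-congˡ (≈-reflexive e)) (≈-sym (⊕-assoc A B (h l))))
                                   (⊕-optionʳ (A ⊕ B) C l))
           ]′ (⊕-option B C k))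

⊕-identityˡ : ∀ G → zeroG ⊕ G ≈ G
⊕-identityˡ (mk _ g) = bisim (λ k → ≈opt k (⊕-identityˡ (g k))) (λ k → ≈opt k (≈-sym (⊕-identityˡ (g k))))

⊕-isCommutativeMonoid : IsCommutativeMonoid _≈_ _⊕_ zeroG
⊕-isCommutativeMonoid = record
  { isMonoid = record
    { isSemigroup = record
      { isMagma = record { isEquivalence = ≈-isEquivalence ; ∙-cong = ⊕-cong }
      ; assoc = ⊕-assoc
      }
    ; identity = ⊕-identityˡ , λ G → ≈-trans (⊕-comm G zeroG) (⊕-identityˡ G)
    }
  ; comm = ⊕-comm
  }

⊕-commutativeMonoid : CommutativeMonoid 0ℓ 0ℓ
⊕-commutativeMonoid = record { isCommutativeMonoid = ⊕-isCommutativeMonoid }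

open CommutativeMonoid ⊕-commutativeMonoid using (identityʳ)
open import Algebra.Properties.CommutativeSemigroup
  (CommutativeMonoid.commutativeSemigroup ⊕-commutativeMonoid) using (x∙yz≈y∙xz)

⋆-descendant : ∀ {𝒜 : GameSet} → (∀ G G' → 𝒜 G → Option G' G → 𝒜 G')
  → ∀ A → 𝒜 A → #opts A > 0 → Σ Game λ S → 𝒜 S × S ≈ ⋆
⋆-descendant options-closed (mk n f) A∈𝒜 n>0 with any? (λ i → 0 <? #opts (f i))
... | yes (i , fᵢ>0) = ⋆-descendant options-closed (f i) (options-closed _ _ A∈𝒜 (i , refl)) fᵢ>0
... | no no-grandchild = mk n f , A∈𝒜 ,
  ≈-intro (λ i → ≈opt zero (fᵢ≈zeroG i)) (λ _ → ≈opt (fromℕ< n>0) (≈-sym (fᵢ≈zeroG _)))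
  where
  fᵢ≈zeroG : ∀ i → f i ≈ zeroG
  fᵢ≈zeroG i = no-options⇒≈zeroG (f i) (n≤0⇒n≡0 (≮⇒≥ λ fᵢ>0 → no-grandchild (i , fᵢ>0)))

≈⋆⊕no-options-𝒫 : ∀ {S W} → S ≈ ⋆ → #opts W ≡ 0 → o⁻ (S ⊕ W) ≡ 𝒫
≈⋆⊕no-options-𝒫 {W = W} S≈⋆ W-none =
  𝒫-resp-≈ (≈-sym (≈-trans (⊕-cong S≈⋆ (no-options⇒≈zeroG W W-none)) (identityʳ ⋆))) refl

option∈meximal : ∀ 𝒜 X i → InMeximal 𝒜 X (opts X i)
option∈meximal 𝒜 X i (W , _ , XW𝒫 , XᵢW𝒫) =
  𝒩≢𝒫 (trans (sym (𝒫⇒≈∈-𝒩 XW𝒫 (⊕-optionˡ X W i))) XᵢW𝒫)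

≈⋆∈meximal : ∀ 𝒜 {X S} → #opts X ≡ 0 → S ≈ ⋆ → InMeximal 𝒜 X S
≈⋆∈meximal 𝒜 {X} {S} X-none S≈⋆ (W , _ , XW𝒫 , SW𝒫) = 𝒩≢𝒫 (trans (sym SW𝒩) SW𝒫)
  where
  W𝒫 : o⁻ W ≡ 𝒫
  W𝒫 = 𝒫-resp-≈ (≈-trans (⊕-congʳ (no-options⇒≈zeroG X X-none)) (⊕-identityˡ W)) XW𝒫
  W≈∈S⊕W : W ≈∈ S ⊕ W
  W≈∈S⊕W = ≈∈-respʳ (⊕-congʳ (≈-sym S≈⋆))
             (≈∈-respˡ (≈-sym (⊕-identityˡ W)) (⊕-optionˡ ⋆ W zero))
  SW𝒩 : o⁻ (S ⊕ W) ≡ 𝒩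
  SW𝒩 = ≈∈-𝒫⇒𝒩 W≈∈S⊕W W𝒫

meximal-nonempty : ∀ {𝒜 : GameSet} → (∀ G G' → 𝒜 G → Option G' G → 𝒜 G')
  → ∀ {S} → 𝒜 S → S ≈ ⋆ → ∀ X → 𝒜 X → Σ Game λ Z → 𝒜 Z × InMeximal 𝒜 X Z
meximal-nonempty {𝒜} _ {S} S∈𝒜 S≈⋆ X@(mk zero _) _ = S , S∈𝒜 , ≈⋆∈meximal 𝒜 {X} refl S≈⋆
meximal-nonempty {𝒜} options-closed _ _ X@(mk (suc _) f) X∈𝒜 =
  f zero , options-closed _ _ X∈𝒜 (zero , refl) , option∈meximal 𝒜 X zero

-- Sums with copies of a game

infix 7 _⊕[_]_

_⊕[_]_ : Game → ℕ → Game → Game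
Y ⊕[ zero ] Q = Y
Y ⊕[ suc k ] Q = Q ⊕ (Y ⊕[ k ] Q)

copies-closed : ∀ {𝒜 : GameSet} → (∀ G H → 𝒜 G → 𝒜 H → 𝒜 (G ⊕ H))
  → ∀ {Y Q} → 𝒜 Y → 𝒜 Q → ∀ k → 𝒜 (Y ⊕[ k ] Q)
copies-closed sums-closed Y∈𝒜 Q∈𝒜 zero = Y∈𝒜
copies-closed sums-closed Y∈𝒜 Q∈𝒜 (suc k) = sums-closed _ _ Q∈𝒜 (copies-closed sums-closed Y∈𝒜 Q∈𝒜 k)

⊕-copies-assoc : ∀ A Y Q k → A ⊕ (Y ⊕[ k ] Q) ≈ (A ⊕ Y) ⊕[ k ] Q
⊕-copies-assoc A Y Q zero = ≈-refl
⊕-copies-assoc A Y Q (suc k) = ≈-trans (x∙yz≈y∙xz A Q (Y ⊕[ k ] Q)) (⊕-congˡ (⊕-copies-assoc A Y Q k))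

copies-⊕-copies : ∀ Y V Q a b → (Y ⊕[ a ] Q) ⊕ (V ⊕[ b ] Q) ≈ (Y ⊕ V) ⊕[ a + b ] Q
copies-⊕-copies Y V Q zero b = ⊕-copies-assoc Y V Q b
copies-⊕-copies Y V Q (suc a) b =
  ≈-trans (⊕-assoc Q (Y ⊕[ a ] Q) (V ⊕[ b ] Q)) (⊕-congˡ (copies-⊕-copies Y V Q a b))

data CopiesOption (Y Q : Game) : ℕ → Game → Set where
  base-option : ∀ {k} i → CopiesOption Y Q k (opts Y i ⊕[ k ] Q)
  copy-option : ∀ {k} j → CopiesOption Y Q (suc k) ((opts Q j ⊕ Y) ⊕[ k ] Q)

CopiesOption-suc : ∀ {Y Q k Z} → CopiesOption Y Q k Z → CopiesOption Y Q (suc k) (Q ⊕ Z)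
CopiesOption-suc (base-option i) = base-option i
CopiesOption-suc (copy-option j) = copy-option j

copies-option-shape : ∀ Y Q k l → Σ Game λ Z → CopiesOption Y Q k Z × opts (Y ⊕[ k ] Q) l ≈ Z
copies-option-shape Y Q zero l = opts Y l , base-option l , ≈-refl
copies-option-shape Y Q (suc k) l with ⊕-option Q (Y ⊕[ k ] Q) l
... | inj₁ (j , e) = _ , copy-option j , ≈-trans (≈-reflexive e) (⊕-copies-assoc (opts Q j) Y Q k)
... | inj₂ (l' , e) =
  let Z , shape , r = copies-option-shape Y Q k l'
  in Q ⊕ Z , CopiesOption-suc shape , ≈-trans (≈-reflexive e) (⊕-congˡ r)

CopiesOption⇒≈∈ : ∀ {Y Q k Z} → CopiesOption Y Q k Z → Z ≈∈ Y ⊕[ k ] Q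
CopiesOption⇒≈∈ {k = zero} (base-option i) = ≈opt i ≈-refl
CopiesOption⇒≈∈ {k = suc k} (base-option i) = ≈∈-⊕ʳ (CopiesOption⇒≈∈ {k = k} (base-option i))
CopiesOption⇒≈∈ {Y} {Q} {suc k} (copy-option j) =
  ≈∈-respˡ (≈-sym (⊕-copies-assoc (opts Q j) Y Q k)) (⊕-optionˡ Q (Y ⊕[ k ] Q) j)

module Extension
  (𝒜 : GameSet) (closed : Closed 𝒜)
  (S : Game) (S∈𝒜 : 𝒜 S) (S≈⋆ : S ≈ ⋆)
  (X : Game) (X∈𝒜 : 𝒜 X)
  (G : Game) (G-options∈𝒜 : ∀ G' → Option G' G → 𝒜 G')
  (meximal : OptionImageIsMeximal 𝒜 G X)
  where

  ⊕∈𝒜 : ∀ {A B} → 𝒜 A → 𝒜 B → 𝒜 (A ⊕ B)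
  ⊕∈𝒜 = proj₁ closed _ _

  opts∈𝒜 : ∀ {A} → 𝒜 A → ∀ i → 𝒜 (opts A i)
  opts∈𝒜 {A} A∈𝒜 i = proj₂ closed A _ A∈𝒜 (opts-option A i)

  G-opts∈𝒜 : ∀ j → 𝒜 (opts G j)
  G-opts∈𝒜 j = G-options∈𝒜 _ (opts-option G j)

  G-option≡ : ∀ {Z} → 𝒜 Z → InMeximal 𝒜 X Z → Σ (Fin (#opts G)) λ j → opts G j ≡[ 𝒜 ] Z
  G-option≡ Z∈𝒜 Z∈M with proj₂ meximal _ Z∈𝒜 Z∈M
  ... | G' , G'∈G , G'≡Z with option-index G'∈G
  ...   | j , refl = j , G'≡Z

  G-has-option : Fin (#opts G)
  G-has-option =
    let Z , Z∈𝒜 , Z∈M = meximal-nonempty (proj₂ closed) S∈𝒜 S≈⋆ X X∈𝒜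
    in proj₁ (G-option≡ Z∈𝒜 Z∈M)

  module AddCopy
    (k : ℕ) (fewer-copies : ∀ Y → 𝒜 Y → o⁻ (Y ⊕[ k ] G) ≡ o⁻ (Y ⊕[ k ] X))
    {Y : Game} (Y∈𝒜 : 𝒜 Y)
    (base-options : ∀ i → o⁻ (opts Y i ⊕[ suc k ] G) ≡ o⁻ (opts Y i ⊕[ suc k ] X))
    where

    W : Game
    W = Y ⊕[ k ] X

    W∈𝒜 : 𝒜 W
    W∈𝒜 = copies-closed (proj₁ closed) Y∈𝒜 X∈𝒜 k

    base-option≈∈ : ∀ Q i → opts Y i ⊕[ suc k ] Q ≈∈ Y ⊕[ suc k ] Q
    base-option≈∈ Q i = CopiesOption⇒≈∈ {Y} {Q} {suc k} (base-option i)

    copy-option≈∈ : ∀ j → (opts G j ⊕ Y) ⊕[ k ] G ≈∈ Y ⊕[ suc k ] G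
    copy-option≈∈ j = CopiesOption⇒≈∈ {Y} {G} {suc k} (copy-option j)

    copy-outcome : ∀ j → o⁻ ((opts G j ⊕ Y) ⊕[ k ] G) ≡ o⁻ (opts G j ⊕ W)
    copy-outcome j = trans (fewer-copies _ (⊕∈𝒜 (G-opts∈𝒜 j) Y∈𝒜))
                           (o⁻-resp-≈ (≈-sym (⊕-copies-assoc (opts G j) Y X k)))

    meximal-𝒫⇒𝒩 : ∀ {Z} → 𝒜 Z → InMeximal 𝒜 X Z → o⁻ (Z ⊕ W) ≡ 𝒫 → o⁻ (Y ⊕[ suc k ] G) ≡ 𝒩
    meximal-𝒫⇒𝒩 Z∈𝒜 Z∈M ZW𝒫 =
      let j , Gⱼ≡Z = G-option≡ Z∈𝒜 Z∈M
      in ≈∈-𝒫⇒𝒩 (copy-option≈∈ j) (trans (copy-outcome j) (trans (Gⱼ≡Z W W∈𝒜) ZW𝒫))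

    𝒫⇒𝒫 : o⁻ (Y ⊕[ suc k ] X) ≡ 𝒫 → o⁻ (Y ⊕[ suc k ] G) ≡ 𝒫
    𝒫⇒𝒫 XW𝒫 = options-𝒩⇒𝒫 (Y ⊕[ suc k ] G) (index (copy-option≈∈ G-has-option)) λ l →
      let Z , shape , r = copies-option-shape Y G (suc k) l
      in trans (o⁻-resp-≈ r) (shape-𝒩 shape)
      where
      shape-𝒩 : ∀ {Z} → CopiesOption Y G (suc k) Z → o⁻ Z ≡ 𝒩
      shape-𝒩 (base-option i) = trans (base-options i) (𝒫⇒≈∈-𝒩 XW𝒫 (base-option≈∈ X i))
      shape-𝒩 (copy-option j) = trans (copy-outcome j) (≢𝒫⇒≡𝒩 λ GⱼW𝒫 →
        proj₁ meximal (opts G j) (opts-option G j) (W , W∈𝒜 , XW𝒫 , GⱼW𝒫))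

    𝒩⇒𝒩 : o⁻ (Y ⊕[ suc k ] X) ≡ 𝒩 → o⁻ (Y ⊕[ suc k ] G) ≡ 𝒩
    𝒩⇒𝒩 XW𝒩 with 𝒩-cases (X ⊕ W) XW𝒩
    ... | inj₁ XW-none =
      let X-none , W-none = #opts-⊕≡0 X W XW-none
      in meximal-𝒫⇒𝒩 S∈𝒜 (≈⋆∈meximal 𝒜 {X} X-none S≈⋆) (≈⋆⊕no-options-𝒫 S≈⋆ W-none)
    ... | inj₂ (l , l𝒫) with copies-option-shape Y X (suc k) l
    ...   | _ , base-option i , r = ≈∈-𝒫⇒𝒩 (base-option≈∈ G i)
              (trans (base-options i) (trans (sym (o⁻-resp-≈ r)) l𝒫))
    ...   | _ , copy-option j , r = meximal-𝒫⇒𝒩 (opts∈𝒜 X∈𝒜 j) (option∈meximal 𝒜 X j)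
              (trans (o⁻-resp-≈ (⊕-copies-assoc (opts X j) Y X k)) (trans (sym (o⁻-resp-≈ r)) l𝒫))

    copies-outcome-suc : o⁻ (Y ⊕[ suc k ] G) ≡ o⁻ (Y ⊕[ suc k ] X)
    copies-outcome-suc = outcome-by-cases 𝒫⇒𝒫 𝒩⇒𝒩

  copies-outcome : ∀ k Y → 𝒜 Y → o⁻ (Y ⊕[ k ] G) ≡ o⁻ (Y ⊕[ k ] X)
  copies-outcome zero _ _ = refl
  copies-outcome (suc k) (mk n f) Y∈𝒜 = AddCopy.copies-outcome-suc k (copies-outcome k) Y∈𝒜
    (λ i → copies-outcome (suc k) (f i) (opts∈𝒜 Y∈𝒜 i))

  ℬ : GameSet
  ℬ = cl (𝒜 ∪｛ G ｝)

  record NormalForm (Z : Game) : Set where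
    constructor normal
    field
      core    : Game
      copies  : ℕ
      core∈𝒜  : 𝒜 core
      ≈normal : Z ≈ core ⊕[ copies ] G

    with-X : Game
    with-X = core ⊕[ copies ] X

    with-X∈𝒜 : 𝒜 with-X
    with-X∈𝒜 = copies-closed (proj₁ closed) core∈𝒜 X∈𝒜 copies

  open NormalForm using (with-X; with-X∈𝒜)

  normal-𝒜 : ∀ {K} → 𝒜 K → NormalForm K
  normal-𝒜 K∈𝒜 = normal _ 0 K∈𝒜 ≈-refl

  E : Game
  E = opts S (index (≈-bwd S≈⋆ zero))

  E≈zeroG : E ≈ zeroG
  E≈zeroG = ≈-sym (≈opts (≈-bwd S≈⋆ zero))

  normal-G : NormalForm G
  normal-G = normal E 1 (opts∈𝒜 S∈𝒜 _) (≈-sym (≈-trans (⊕-congˡ E≈zeroG) (identityʳ G)))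

  normal-option : ∀ {Z} → NormalForm Z → ∀ i → NormalForm (opts Z i)
  normal-option {Z} (normal Y k Y∈𝒜 Z≈) i =
    let ≈opt l r = ≈-fwd Z≈ i
        _ , shape , s = copies-option-shape Y G k l
    in from-shape shape (≈-trans r s)
    where
    from-shape : ∀ {k Z'} → CopiesOption Y G k Z' → opts Z i ≈ Z' → NormalForm (opts Z i)
    from-shape {k} (base-option i') ≈Z' = normal (opts Y i') k (opts∈𝒜 Y∈𝒜 i') ≈Z'
    from-shape {suc k} (copy-option j) ≈Z' = normal (opts G j ⊕ Y) k (⊕∈𝒜 (G-opts∈𝒜 j) Y∈𝒜) ≈Z'

  normal-form : ∀ {Z} → ℬ Z → NormalForm Z
  normal-form (base (inj₁ Z∈𝒜)) = normal-𝒜 Z∈𝒜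
  normal-form (base (inj₂ refl)) = normal-G
  normal-form (sum Z∈ℬ Z'∈ℬ) =
    let normal Y a Y∈𝒜 Z≈ = normal-form Z∈ℬ
        normal V b V∈𝒜 Z'≈ = normal-form Z'∈ℬ
    in normal (Y ⊕ V) (a + b) (⊕∈𝒜 Y∈𝒜 V∈𝒜) (≈-trans (⊕-cong Z≈ Z'≈) (copies-⊕-copies Y V G a b))
  normal-form (opt Z∈ℬ Z'∈Z) with option-index Z'∈Z
  ... | i , refl = normal-option (normal-form Z∈ℬ) i

  o⁻-with-X : ∀ {Z Z'} (nZ : NormalForm Z) (nZ' : NormalForm Z') → o⁻ (Z ⊕ Z') ≡ o⁻ (with-X nZ ⊕ with-X nZ')
  o⁻-with-X {Z} {Z'} (normal Y a Y∈𝒜 Z≈) (normal V b V∈𝒜 Z'≈) = begin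
    o⁻ (Z ⊕ Z')                      ≡⟨ o⁻-resp-≈ (≈-trans (⊕-cong Z≈ Z'≈) (copies-⊕-copies Y V G a b)) ⟩
    o⁻ ((Y ⊕ V) ⊕[ a + b ] G)        ≡⟨ copies-outcome (a + b) (Y ⊕ V) (⊕∈𝒜 Y∈𝒜 V∈𝒜) ⟩
    o⁻ ((Y ⊕ V) ⊕[ a + b ] X)        ≡⟨ o⁻-resp-≈ (≈-sym (copies-⊕-copies Y V X a b)) ⟩
    o⁻ ((Y ⊕[ a ] X) ⊕ (V ⊕[ b ] X)) ∎
    where open ≡-Reasoning

  ≡ℬ-with-X : ∀ {Z} (nZ : NormalForm Z) → Z ≡[ ℬ ] with-X nZ
  ≡ℬ-with-X nZ Z' Z'∈ℬ =
    let nZ' = normal-form Z'∈ℬ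
    in trans (o⁻-with-X nZ nZ') (sym (o⁻-with-X (normal-𝒜 (with-X∈𝒜 nZ)) nZ'))

  ≡𝒜⇒≡ℬ : ∀ {K K'} → 𝒜 K → 𝒜 K' → K ≡[ 𝒜 ] K' → K ≡[ ℬ ] K'
  ≡𝒜⇒≡ℬ {K} {K'} K∈𝒜 K'∈𝒜 K≡K' Z Z∈ℬ = begin
    o⁻ (K ⊕ Z)          ≡⟨ o⁻-with-X (normal-𝒜 K∈𝒜) nZ ⟩
    o⁻ (K ⊕ with-X nZ)  ≡⟨ K≡K' _ (with-X∈𝒜 nZ) ⟩
    o⁻ (K' ⊕ with-X nZ) ≡⟨ sym (o⁻-with-X (normal-𝒜 K'∈𝒜) nZ) ⟩
    o⁻ (K' ⊕ Z)         ∎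
    where
    open ≡-Reasoning
    nZ : NormalForm Z
    nZ = normal-form Z∈ℬ

  ≡𝒜⇔≡ℬ : ∀ {K K'} → 𝒜 K → 𝒜 K' → (K ≡[ 𝒜 ] K') ⇔ (K ≡[ ℬ ] K')
  ≡𝒜⇔≡ℬ K∈𝒜 K'∈𝒜 = mk⇔ (≡𝒜⇒≡ℬ K∈𝒜 K'∈𝒜) λ K≡K' Z Z∈𝒜 → K≡K' Z (base (inj₁ Z∈𝒜))

  ℬ-represented-in-𝒜 : ∀ {Z} → ℬ Z → Σ Game λ K → 𝒜 K × Z ≡[ ℬ ] K
  ℬ-represented-in-𝒜 Z∈ℬ = let nZ = normal-form Z∈ℬ in with-X nZ , with-X∈𝒜 nZ , ≡ℬ-with-X nZ

  G≡ℬ : ∀ {H} → 𝒜 H → H ≡[ 𝒜 ] X → G ≡[ ℬ ] H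
  G≡ℬ {H} H∈𝒜 H≡X Z Z∈ℬ = begin
    o⁻ (G ⊕ Z)       ≡⟨ ≡ℬ-with-X normal-G Z Z∈ℬ ⟩
    o⁻ ((X ⊕ E) ⊕ Z) ≡⟨ o⁻-resp-≈ (⊕-congʳ (≈-trans (⊕-congˡ E≈zeroG) (identityʳ X))) ⟩
    o⁻ (X ⊕ Z)       ≡⟨ ≡𝒜⇒≡ℬ X∈𝒜 H∈𝒜 (λ W W∈𝒜 → sym (H≡X W W∈𝒜)) Z Z∈ℬ ⟩
    o⁻ (H ⊕ Z)       ∎
    where open ≡-Reasoning

corollary5p9 : (𝒜 : GameSet) → Closed 𝒜
    → Σ Game (λ A → 𝒜 A × #opts A > 0)
    → (X : Game) → 𝒜 X
    → (G : Game) → (∀ G' → Option G' G → 𝒜 G')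
    → OptionImageIsMeximal 𝒜 G X
    → ((K K' : Game) → 𝒜 K → 𝒜 K' → (K ≡[ 𝒜 ] K') ⇔ (K ≡[ cl (𝒜 ∪｛ G ｝) ] K'))
      × ((Y : Game) → cl (𝒜 ∪｛ G ｝) Y → Σ Game (λ K → 𝒜 K × Y ≡[ cl (𝒜 ∪｛ G ｝) ] K))
      × ((H : Game) → 𝒜 H → H ≡[ 𝒜 ] X → G ≡[ cl (𝒜 ∪｛ G ｝) ] H)
corollary5p9 𝒜 closed (A , A∈𝒜 , A-has-option) X X∈𝒜 G G-options∈𝒜 meximal
  with ⋆-descendant (proj₂ closed) A A∈𝒜 A-has-option
... | S , S∈𝒜 , S≈⋆ = (λ _ _ → ≡𝒜⇔≡ℬ) , (λ _ → ℬ-represented-in-𝒜) , (λ _ → G≡ℬ)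
  where open Extension 𝒜 closed S S∈𝒜 S≈⋆ X X∈𝒜 G G-options∈𝒜 meximal
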